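{- Let $m\in\{0\}\cup\mathbb N$, let $Q=(\mathbb N,\mathbb Z,m\mathbb Z,m\mathbb Z,m\mathbb Z,\mathbb Z)$ and let $p$ be a two-colored partition. Then $Z(\{p\})\leq Q$ if and only if $\delta_p(\alpha,\beta)\in m\mathbb Z$ for every block $B$ of $p$ and all (not necessarily distinct) legs $\alpha,\beta\in B$.
   Context: A two-colored partition $p$ consists of a lower row $R_L$ and an upper row $R_U$ (disjoint, possibly empty, finite totally ordered sets), a decomposition of $P_p=R_L\cup R_U$ into disjoint nonempty blocks (whose elements are called legs), and a coloring of each point by $\circ$ or $\bullet$. Orientation: the cyclic order on $P_p$ agreeing with the order of $R_L$ on $R_L$, with the reverse order of $R_U$ on $R_U$, with the maximum of $R_U$ succeeding the maximum of $R_L$ and the minimum of $R_L$ succeeding the minimum of $R_U$; intervals $]\alpha,\beta[_p$, $]\alpha,\beta]_p$ for distinct $\alpha,\beta$ refer to this cyclic order. Normalized color: color for lower points, inverse color for upper points. $\sigma_p(S)$: number of normalized-white minus number of normalized-black points of $S$; $\Sigma(p)=\sigma_p(P_p)$. Color distance: $\delta_p(\alpha,\alpha)=\Sigma(p)$; for $\alpha\ne\beta$, $\delta_p(\alpha,\beta)=\sigma_p(]\alpha,\beta[_p)$ if their normalized colors differ and $\sigma_p(]\alpha,\beta]_p)$ if they agree. Blocks $B\neq B'$ cross if there are pairwise distinct $\alpha,\beta\in B$, $\alpha',\beta'\in B'$ appearing in the cyclic order in the order $\alpha,\alpha',\beta,\beta'$. For a set $\mathcal S$ of partitions: $F(\mathcal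 S)=\{|B|: p\in\mathcal S, B$ block of $p\}$; $V(\mathcal S)=\{\sigma_p(B): p\in\mathcal S,B$ block of $p\}$; $\Sigma(\mathcal S)=\{\Sigma(p):p\in\mathcal S\}$; $L(\mathcal S)$ (resp. $K(\mathcal S)$) is the set of $\delta_p(\alpha_1,\alpha_2)$ over $p\in\mathcal S$, blocks $B$ of $p$, $\alpha_1\neq\alpha_2\in B$ with $]\alpha_1,\alpha_2[_p\cap B=\emptyset$ and $\sigma_p(\{\alpha_1,\alpha_2\})\neq0$ (resp. $=0$); $X(\mathcal S)$ is the set of $\delta_p(\alpha_1,\alpha_2)$ over $p\in\mathcal S$, crossing blocks $B_1,B_2$ of $p$, $\alpha_1\in B_1,\alpha_2\in B_2$. $Z=(F,V,\Sigma,L,K,X)$ and $\leq$ is componentwise inclusion. $\mathbb N=\{1,2,\dots\}$. -}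

module Defs where

open import Data.Nat using (ℕ; suc; _+_; _∸_; _<ᵇ_; _≡ᵇ_; _≤_)
open import Data.Nat using () renaming (_≟_ to _ℕ≟_)
open import Data.Fin using (Fin; toℕ; _≟_)
open import Data.Fin.Base using ()
open import Data.List using (List; map; _++_; foldr)
open import Data.List.Base using ()
open import Data.Fin.Base using ()
open import Data.Sum using (_⊎_; inj₁; inj₂)
open import Data.Sum.Properties using (≡-dec)
open import Data.Bool using (Bool; true; false; if_then_else_; _∧_; _∨_; not)
open import Data.Integer using (ℤ; +_; -[1+_])
  renaming (_+_ to _+ℤ_)
open import Data.Integer.Divisibility using (_∣_)
open import Data.Unit using (⊤)
open import Data.Product using (Σ; _×_; ∃; ∃-syntax; _,_)
open import Relation.Binary.PropositionalEquality using (_≡_; _≢_)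
open import Relation.Nullary using (yes; no; Dec)
import Data.List as L
import Data.Fin as F

data Color : Set where
  white black : Color

invert : Color → Color
invert white = black
invert black = white

_≟c_ : (a b : Color) → Dec (a ≡ b)
white ≟c white = yes _≡_.refl
white ≟c black = no λ ()
black ≟c white = no λ ()
black ≟c black = yes _≡_.refl

-- Points: lower row R_L = Fin k (inj₁), upper row R_U = Fin l (inj₂),
-- each totally ordered by the order of Fin.
Pt : ℕ → ℕ → Set
Pt k l = Fin k ⊎ Fin l

-- A two-colored partition: the block decomposition is given by a label
-- function (blocks = fibres of blk; every such block is nonempty), and
-- a coloring of every point.
record Partition : Set where
  field
    k   : ℕ
    l   : ℕ
    blk : Pt k l → ℕ
    col : Pt k l → Color
open Partition public

module _ (p : Partition) where

  Point : Set
  Point = Pt (k p) (l p)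

  allPoints : List Point
  allPoints = map inj₁ (L.allFin (k p)) ++ map inj₂ (L.allFin (l p))

  _≟pt_ : (a b : Point) → Dec (a ≡ b)
  _≟pt_ = ≡-dec _≟_ _≟_

  -- position in the cyclic order: lower row in increasing order, then the
  -- upper row in decreasing order (max R_U right after max R_L, and
  -- min R_L right after min R_U, cyclically)
  pos : Point → ℕ
  pos (inj₁ i) = toℕ i
  pos (inj₂ j) = k p + (l p ∸ suc (toℕ j))

  -- γ ∈ ]α,β[_p  (for α ≠ β)
  inOpen : Point → Point → Point → Bool
  inOpen α β γ =
    if pos α <ᵇ pos β
    then (pos α <ᵇ pos γ) ∧ (pos γ <ᵇ pos β)
    else (pos α <ᵇ pos γ) ∨ (pos γ <ᵇ pos β)

  inHalf : Point → Point → Point → Bool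
  inHalf α β γ = inOpen α β γ ∨ (pos γ ≡ᵇ pos β)

  ncol : Point → Color
  ncol (inj₁ i) = col p (inj₁ i)
  ncol (inj₂ j) = invert (col p (inj₂ j))

  wt : Color → ℤ
  wt white = + 1
  wt black = -[1+ 0 ]

  σ : (Point → Bool) → ℤ
  σ S = foldr _+ℤ_ (+ 0) (map (λ x → if S x then wt (ncol x) else + 0) allPoints)

  Σp : ℤ
  Σp = σ (λ _ → true)

  blockOf : Point → Point → Bool
  blockOf x y = blk p x ≡ᵇ blk p y

  SameBlock : Point → Point → Set
  SameBlock x y = blk p x ≡ blk p y

  pair : Point → Point → Point → Bool
  pair α β γ = (pos γ ≡ᵇ pos α) ∨ (pos γ ≡ᵇ pos β)

  δ : Point → Point → ℤ
  δ α β with α ≟pt β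
  ... | yes _ = Σp
  ... | no _ with ncol α ≟c ncol β
  ...   | yes _ = σ (inHalf α β)
  ...   | no _  = σ (inOpen α β)

  blockSize : Point → ℕ
  blockSize x = L.length (L.filter (λ y → blk p x ℕ≟ blk p y) allPoints)

  Crossing : Point → Point → Set
  Crossing x y =
    blk p x ≢ blk p y ×
    ∃[ α ] ∃[ β ] ∃[ α' ] ∃[ β' ]
      (SameBlock α x × SameBlock β x × SameBlock α' y × SameBlock β' y ×
       α ≢ β × α' ≢ β' ×
       inOpen α β α' ≡ true × inOpen β α β' ≡ true)

  Consecutive : Point → Point → Set
  Consecutive α₁ α₂ =
    SameBlock α₁ α₂ × α₁ ≢ α₂ ×
    (∀ γ → inOpen α₁ α₂ γ ≡ true → blk p γ ≢ blk p α₁)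

record Tuple : Set₁ where
  field
    Fc : ℕ → Set
    Vc : ℤ → Set
    Σc : ℤ → Set
    Lc : ℤ → Set
    Kc : ℤ → Set
    Xc : ℤ → Set
open Tuple public

_⊆ℕ_ : (ℕ → Set) → (ℕ → Set) → Set
A ⊆ℕ B = ∀ n → A n → B n

_⊆ℤ_ : (ℤ → Set) → (ℤ → Set) → Set
A ⊆ℤ B = ∀ z → A z → B z

_≤Z_ : Tuple → Tuple → Set
T ≤Z U = (Fc T ⊆ℕ Fc U) × (Vc T ⊆ℤ Vc U) × (Σc T ⊆ℤ Σc U) ×
         (Lc T ⊆ℤ Lc U) × (Kc T ⊆ℤ Kc U) × (Xc T ⊆ℤ Xc U)

Z : (Partition → Set) → Tuple
Fc (Z S) n = ∃[ p ] (S p × ∃[ x ] (blockSize p x ≡ n))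
Vc (Z S) z = ∃[ p ] (S p × ∃[ x ] (σ p (blockOf p x) ≡ z))
Σc (Z S) z = ∃[ p ] (S p × Σp p ≡ z)
Lc (Z S) z = ∃[ p ] (S p × ∃[ α₁ ] ∃[ α₂ ]
               (Consecutive p α₁ α₂ × σ p (pair p α₁ α₂) ≢ + 0 × δ p α₁ α₂ ≡ z))
Kc (Z S) z = ∃[ p ] (S p × ∃[ α₁ ] ∃[ α₂ ]
               (Consecutive p α₁ α₂ × σ p (pair p α₁ α₂) ≡ + 0 × δ p α₁ α₂ ≡ z))
Xc (Z S) z = ∃[ p ] (S p × ∃[ α₁ ] ∃[ α₂ ]
               (Crossing p α₁ α₂ × δ p α₁ α₂ ≡ z))

-- ℕ = {1,2,...}, ℤ, and mℤ as subsets
ℕ⁺ : ℕ → Set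
ℕ⁺ n = 1 ≤ n

allℤ : ℤ → Set
allℤ _ = ⊤

mℤ : ℕ → ℤ → Set
mℤ m z = (+ m) ∣ z

Q : ℕ → Tuple
Fc (Q m) = ℕ⁺
Vc (Q m) = allℤ
Σc (Q m) = mℤ m
Lc (Q m) = mℤ m
Kc (Q m) = mℤ m
Xc (Q m) = allℤ

module Submission where

-- For legs α ≠ β, the interval ]α,β[ is the disjoint union of ]α,γ[, {γ} and ]γ,β[ for every
-- γ in it, and the endpoint corrections in δ depend only on the three normalized colours in a
-- way that cancels, so δ(α,β) = δ(α,γ) + δ(γ,β). Splitting at the legs of the block lying
-- strictly between α and β writes δ(α,β) as a sum of colour distances of consecutive legs,
-- i.e. of elements of L ∪ K, while δ(α,α) = Σ(p). Conversely Σ, L and K consist of such colour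
-- distances, and F, V and X impose nothing beyond blocks being nonempty.

open import Defs
open import Data.Nat using (ℕ)
open import Data.Integer using (+_)
open import Data.Integer.Divisibility using (_∣_)
open import Relation.Binary.PropositionalEquality using (_≡_)
open import Function.Bundles using (_⇔_)

open import Data.Bool using (Bool; true; false; if_then_else_; _∧_; _∨_; not; T)
import Data.Bool as Bool
open import Data.Bool.Properties using (not-¬)
open import Data.Empty using (⊥)
open import Data.Fin using () renaming (zero to fzero)
open import Data.Fin.Properties using (toℕ-injective; toℕ<n)
open import Data.Integer using (ℤ; -[1+_]; _*_) renaming (_+_ to _+ℤ_)
import Data.Integer.Divisibility.Signed as Signed
import Data.Integer.Properties as ℤ
open import Algebra.Properties.CommutativeSemigroup ℤ.+-commutativeSemigroup
  using (interchange; xy∙z≈xz∙y)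
open import Data.List using (List; []; _∷_; map; foldr; filter; length; allFin)
open import Data.List.Membership.Propositional using (_∈_; lose)
open import Data.List.Membership.Propositional.Properties
  using (∈-allFin; ∈-map⁺; ∈-map⁻; ∈-++⁺ˡ; ∈-++⁺ʳ; ∈-filter⁺; ∈-length)
open import Data.List.Properties using (filter-notAll; map-cong)
open import Data.List.Relation.Binary.Sublist.Heterogeneous.Properties
  using (length-mono-≤; ⊆-filter-Sublist)
open import Data.List.Relation.Binary.Sublist.Propositional using (⊆-refl)
open import Data.List.Relation.Unary.All as All using (All; []; _∷_)
open import Data.List.Relation.Unary.AllPairs using (_∷_)
open import Data.List.Relation.Unary.Any using (here; there; any?; satisfied)
open import Data.List.Relation.Unary.Unique.Propositional using (Unique)
open import Data.List.Relation.Unary.Unique.Propositional.Properties using (allFin⁺; map⁺; ++⁺)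
open import Data.Nat using (zero; suc; _+_; _<ᵇ_; _≡ᵇ_; _<_; _≤_; s≤s)
import Data.Nat.Divisibility as ℕ
open import Data.Nat.Induction using (<-wellFounded)
open import Data.Nat.Properties
open import Data.Product using (_×_; _,_)
open import Data.Sum using (inj₁; inj₂)
open import Data.Sum.Properties using (inj₁-injective; inj₂-injective)
open import Data.Unit using (tt)
open import Function using (_∘_)
open import Function.Bundles using (mk⇔)
open import Induction.WellFounded using (Acc; acc)
open import Relation.Binary.Definitions using (tri<; tri≈; tri>)
open import Relation.Binary.PropositionalEquality
  using (_≢_; refl; sym; trans; cong; cong₂; subst; module ≡-Reasoning)
open import Relation.Nullary using (¬_; Dec; yes; no; contradiction)
open import Relation.Nullary.Decidable
  using (does-⇔; dec-true; dec-false; from-yes; decidable-stable; T?; _×-dec_)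
open import Relation.Unary using (Pred; Decidable)

𝟙 : Bool → ℕ
𝟙 true  = 1
𝟙 false = 0

𝟙-≤⇒true : ∀ {a u} → 𝟙 a ≤ 𝟙 u → a ≡ true → u ≡ true
𝟙-≤⇒true {u = true}  _  _    = refl
𝟙-≤⇒true {u = false} () refl

𝟙-∨ : ∀ u e → (e ≡ true → u ≡ false) → 𝟙 (u ∨ e) ≡ 𝟙 u + 𝟙 e
𝟙-∨ true  true  disjoint with () ← disjoint refl
𝟙-∨ true  false _ = refl
𝟙-∨ false e     _ = refl

module _ {a ℓ₁ ℓ₂} {A : Set a} {P : Pred A ℓ₁} {Q : Pred A ℓ₂}
         (P? : Decidable P) (Q? : Decidable Q) (P⊆Q : ∀ {x} → P x → Q x) where

  length-filter-mono : ∀ xs → length (filter P? xs) ≤ length (filter Q? xs)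
  length-filter-mono xs =
    length-mono-≤ (⊆-filter-Sublist P? Q? (λ { refl → P⊆Q }) (⊆-refl {x = xs}))

  length-filter-mono-< : ∀ {y xs} → y ∈ xs → ¬ P y → Q y →
                         length (filter P? xs) < length (filter Q? xs)
  length-filter-mono-< {xs = x ∷ xs} y∈x∷xs ¬Py Qy with P? x | Q? x | y∈x∷xs
  ... | yes Px | _      | here refl  = contradiction Px ¬Py
  ... | no _   | yes _  | here refl  = s≤s (length-filter-mono xs)
  ... | no _   | no ¬Qx | here refl  = contradiction Qy ¬Qx
  ... | yes Px | no ¬Qx | there _    = contradiction (P⊆Q Px) ¬Qx
  ... | yes _  | yes _  | there y∈xs = s≤s (length-filter-mono-< y∈xs ¬Py Qy)
  ... | no _   | yes _  | there y∈xs = m≤n⇒m≤1+n (length-filter-mono-< y∈xs ¬Py Qy)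
  ... | no _   | no _   | there y∈xs = length-filter-mono-< y∈xs ¬Py Qy

module Rank (xs : List ℕ) where

  rank : ℕ → ℕ
  rank x = length (filter (_<? x) xs)

  rank-mono-≤ : ∀ {x y} → x ≤ y → rank x ≤ rank y
  rank-mono-≤ x≤y = length-filter-mono (_<? _) (_<? _) (λ z<x → <-≤-trans z<x x≤y) xs

  rank-mono-< : ∀ {x y} → x ∈ xs → x < y → rank x < rank y
  rank-mono-< x∈xs x<y =
    length-filter-mono-< (_<? _) (_<? _) (λ z<x → <-trans z<x x<y) x∈xs (<-irrefl refl) x<y

  rank<length : ∀ {x} → x ∈ xs → rank x < length xs
  rank<length x∈xs = filter-notAll (_<? _) xs (lose x∈xs (<-irrefl refl))

  rank-<ᵇ : ∀ {x y} → x ∈ xs → (rank x <ᵇ rank y) ≡ (x <ᵇ y)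
  rank-<ᵇ {x} {y} x∈xs = does-⇔ (mk⇔ reflect (rank-mono-< x∈xs)) (rank x <? rank y) (x <? y)
    where
    reflect : rank x < rank y → x < y
    reflect rx<ry = decidable-stable (x <? y) (λ x≮y → <⇒≱ rx<ry (rank-mono-≤ (≮⇒≥ x≮y)))

  rank-≡ᵇ : ∀ {x y} → x ∈ xs → y ∈ xs → (rank x ≡ᵇ rank y) ≡ (x ≡ᵇ y)
  rank-≡ᵇ {x} {y} x∈xs y∈xs = does-⇔ (mk⇔ reflect (cong rank)) (rank x ≟ rank y) (x ≟ y)
    where
    reflect : rank x ≡ rank y → x ≡ y
    reflect rx≡ry with <-cmp x y
    ... | tri< x<y _ _ = contradiction rx≡ry (<⇒≢ (rank-mono-< x∈xs x<y))
    ... | tri≈ _ x≡y _ = x≡y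
    ... | tri> _ _ y<x = contradiction (sym rx≡ry) (<⇒≢ (rank-mono-< y∈xs y<x))

sum : List ℤ → ℤ
sum = foldr _+ℤ_ (+ 0)

module _ {a} {A : Set a} where

  sum-map-+ : ∀ (f g : A → ℤ) xs →
              sum (map (λ x → f x +ℤ g x) xs) ≡ sum (map f xs) +ℤ sum (map g xs)
  sum-map-+ f g []       = refl
  sum-map-+ f g (x ∷ xs) = trans (cong (f x +ℤ g x +ℤ_) (sum-map-+ f g xs))
                                 (interchange (f x) (g x) (sum (map f xs)) (sum (map g xs)))

  sum-map-zero : ∀ {f : A → ℤ} {xs} → All (λ x → f x ≡ + 0) xs → sum (map f xs) ≡ + 0
  sum-map-zero []            = refl
  sum-map-zero (fx≡0 ∷ rest) = cong₂ _+ℤ_ fx≡0 (sum-map-zero rest)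

  sum-map-single : ∀ {f : A → ℤ} {xs y} → Unique xs → y ∈ xs →
                   (∀ x → x ≢ y → f x ≡ + 0) → sum (map f xs) ≡ f y
  sum-map-single {f} (y∉xs ∷ _) (here refl) off =
    trans (cong (f _ +ℤ_) (sum-map-zero (All.map (λ y≢x → off _ (y≢x ∘ sym)) y∉xs)))
          (ℤ.+-identityʳ _)
  sum-map-single (x∉xs ∷ xs-unique) (there y∈xs) off =
    trans (cong₂ _+ℤ_ (off _ (All.lookup x∉xs y∈xs)) (sum-map-single xs-unique y∈xs off))
          (ℤ.+-identityˡ _)

if-as-* : ∀ b z → (if b then z else + 0) ≡ + 𝟙 b * z
if-as-* true  z = sym (ℤ.*-identityˡ z)
if-as-* false z = refl

∣m∣n⇒∣m+n : ∀ {d x y} → d ∣ x → d ∣ y → d ∣ x +ℤ y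
∣m∣n⇒∣m+n {d} {x} {y} d∣x d∣y = Signed.∣⇒∣ᵤ {d} {x +ℤ y}
  (Signed.∣m∣n⇒∣m+n {d} {x} {y} (Signed.∣ᵤ⇒∣ {d} {x} d∣x) (Signed.∣ᵤ⇒∣ {d} {y} d∣y))

-- inOpen p α β γ unfolds to cyclicOpen (pos p α) (pos p β) (pos p γ).
cyclicOpen : ℕ → ℕ → ℕ → Bool
cyclicOpen a b t = if a <ᵇ b then (a <ᵇ t) ∧ (t <ᵇ b) else (a <ᵇ t) ∨ (t <ᵇ b)

cyclicOpen-first : ∀ a b → cyclicOpen a b a ≡ false
cyclicOpen-first a b rewrite dec-false (a <? a) (<-irrefl refl) with a <ᵇ b
... | true  = refl
... | false = refl

cyclicOpen-last : ∀ a b → cyclicOpen a b b ≡ false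
cyclicOpen-last a b rewrite dec-false (b <? b) (<-irrefl refl) with a <ᵇ b
... | true  = refl
... | false = refl

splitsAt : ℕ → ℕ → ℕ → ℕ → Bool
splitsAt a b g t = not (cyclicOpen a b g) ∨
  (𝟙 (cyclicOpen a b t) ≡ᵇ 𝟙 (cyclicOpen a g t) + 𝟙 (t ≡ᵇ g) + 𝟙 (cyclicOpen g b t))

splitsAt-below-4 : ∀ {a} → a < 4 → ∀ {b} → b < 4 → ∀ {g} → g < 4 → ∀ {t} → t < 4 →
                   T (splitsAt a b g t)
splitsAt-below-4 = from-yes (allUpTo? (λ a → allUpTo? (λ b → allUpTo? (λ g → allUpTo?
  (λ t → T? (splitsAt a b g t)) 4) 4) 4) 4)

-- splitsAt only compares a, b, g and t, and replacing them by their ranks among themselves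
-- preserves every comparison; the ranks are below 4, where splitsAt was checked exhaustively.
splitsAt-holds : ∀ a b g t → T (splitsAt a b g t)
splitsAt-holds a b g t = subst T splitsAt-rank
  (splitsAt-below-4 (rank<length a∈) (rank<length b∈) (rank<length g∈) (rank<length t∈))
  where
  abgt : List ℕ
  abgt = a ∷ b ∷ g ∷ t ∷ []
  open Rank abgt
  a∈ : a ∈ abgt
  a∈ = here refl
  b∈ : b ∈ abgt
  b∈ = there (here refl)
  g∈ : g ∈ abgt
  g∈ = there (there (here refl))
  t∈ : t ∈ abgt
  t∈ = there (there (there (here refl)))
  splitsAt-rank : splitsAt (rank a) (rank b) (rank g) (rank t) ≡ splitsAt a b g t
  splitsAt-rank rewrite rank-<ᵇ {y = b} a∈ | rank-<ᵇ {y = g} a∈ | rank-<ᵇ {y = t} a∈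
                      | rank-<ᵇ {y = b} g∈ | rank-<ᵇ {y = t} g∈
                      | rank-<ᵇ {y = b} t∈ | rank-<ᵇ {y = g} t∈ | rank-≡ᵇ t∈ g∈ = refl

cyclicOpen-split : ∀ a b g t → cyclicOpen a b g ≡ true →
  𝟙 (cyclicOpen a b t) ≡ 𝟙 (cyclicOpen a g t) + 𝟙 (t ≡ᵇ g) + 𝟙 (cyclicOpen g b t)
cyclicOpen-split a b g t g∈ab with cyclicOpen a b g | splitsAt-holds a b g t
cyclicOpen-split a b g t refl | .true | holds = ≡ᵇ⇒≡ _ _ holds

-- δ p α β counts its endpoint β exactly when α and β have the same normalized colour.
endWeight : Color → Color → ℤ
endWeight white white = + 1
endWeight black black = -[1+ 0 ]
endWeight _     _     = + 0

module _ (p : Partition) where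

  weight : Point p → ℤ
  weight x = wt p (ncol p x)

  singleton : Point p → Point p → Bool
  singleton β x = pos p x ≡ᵇ pos p β

  lower≢upper : ∀ i j → pos p (inj₁ i) ≢ pos p (inj₂ j)
  lower≢upper i j eq = <⇒≱ (toℕ<n i) (subst (k p ≤_) (sym eq) (m≤m+n (k p) _))

  pos-injective : ∀ {x y} → pos p x ≡ pos p y → x ≡ y
  pos-injective {inj₁ i} {inj₁ j} eq = cong inj₁ (toℕ-injective eq)
  pos-injective {inj₁ i} {inj₂ j} eq = contradiction eq (lower≢upper i j)
  pos-injective {inj₂ i} {inj₁ j} eq = contradiction (sym eq) (lower≢upper j i)
  pos-injective {inj₂ i} {inj₂ j} eq = cong inj₂ (toℕ-injective (suc-injective
    (∸-cancelˡ-≡ (toℕ<n i) (toℕ<n j) (+-cancelˡ-≡ (k p) _ _ eq))))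

  singleton-≡ : ∀ {β x} → singleton β x ≡ true → x ≡ β
  singleton-≡ {β} {x} x∈β = pos-injective (≡ᵇ⇒≡ (pos p x) (pos p β) (subst T (sym x∈β) tt))

  ∈-allPoints : ∀ x → x ∈ allPoints p
  ∈-allPoints (inj₁ i) = ∈-++⁺ˡ (∈-map⁺ inj₁ (∈-allFin i))
  ∈-allPoints (inj₂ j) = ∈-++⁺ʳ _ (∈-map⁺ inj₂ (∈-allFin j))

  allPoints-unique : Unique (allPoints p)
  allPoints-unique =
    ++⁺ (map⁺ inj₁-injective (allFin⁺ (k p))) (map⁺ inj₂-injective (allFin⁺ (l p))) lower∩upper≡∅
    where
    lower∩upper≡∅ : ∀ {x} → x ∈ map inj₁ (allFin (k p)) × x ∈ map inj₂ (allFin (l p)) → ⊥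
    lower∩upper≡∅ (x∈lower , x∈upper) with ∈-map⁻ inj₁ x∈lower | ∈-map⁻ inj₂ x∈upper
    ... | _ , _ , refl | _ , _ , ()

  mass : (Point p → ℕ) → ℤ
  mass c = sum (map (λ x → + c x * weight x) (allPoints p))

  σ≡mass : ∀ S → σ p S ≡ mass (𝟙 ∘ S)
  σ≡mass S = cong sum (map-cong (λ x → if-as-* (S x) _) (allPoints p))

  mass-split : ∀ {c} a b → (∀ x → c x ≡ a x + b x) → mass c ≡ mass a +ℤ mass b
  mass-split {c} a b c≡a+b =
    trans (cong sum (map-cong distrib (allPoints p))) (sum-map-+ _ _ (allPoints p))
    where
    distrib : ∀ x → + c x * weight x ≡ + a x * weight x +ℤ + b x * weight x
    distrib x = trans (cong (λ n → + n * weight x) (c≡a+b x))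
                      (trans (cong (_* weight x) (ℤ.pos-+ (a x) (b x)))
                             (ℤ.*-distribʳ-+ (weight x) (+ a x) (+ b x)))

  σ-singleton : ∀ β → σ p (singleton β) ≡ weight β
  σ-singleton β =
    trans (sum-map-single allPoints-unique (∈-allPoints β) off)
          (cong (λ b → if b then weight β else + 0) (dec-true (pos p β ≟ pos p β) refl))
    where
    off : ∀ x → x ≢ β → (if singleton β x then weight x else + 0) ≡ + 0
    off x x≢β rewrite dec-false (pos p x ≟ pos p β) (x≢β ∘ pos-injective) = refl

  inOpen-first : ∀ α β → inOpen p α β α ≡ false
  inOpen-first α β = cyclicOpen-first (pos p α) (pos p β)

  inOpen-last : ∀ α β → inOpen p α β β ≡ false
  inOpen-last α β = cyclicOpen-last (pos p α) (pos p β)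

  σ-inHalf : ∀ α β → σ p (inHalf p α β) ≡ σ p (inOpen p α β) +ℤ weight β
  σ-inHalf α β = begin
    σ p (inHalf p α β)
      ≡⟨ σ≡mass (inHalf p α β) ⟩
    mass (𝟙 ∘ inHalf p α β)
      ≡⟨ mass-split (𝟙 ∘ inOpen p α β) (𝟙 ∘ singleton β)
           (λ x → 𝟙-∨ (inOpen p α β x) (singleton β x) (β-not-inside x)) ⟩
    mass (𝟙 ∘ inOpen p α β) +ℤ mass (𝟙 ∘ singleton β)
      ≡⟨ sym (cong₂ _+ℤ_ (σ≡mass _) (σ≡mass _)) ⟩
    σ p (inOpen p α β) +ℤ σ p (singleton β)
      ≡⟨ cong (σ p (inOpen p α β) +ℤ_) (σ-singleton β) ⟩
    σ p (inOpen p α β) +ℤ weight β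
      ∎
    where
    open ≡-Reasoning
    β-not-inside : ∀ x → singleton β x ≡ true → inOpen p α β x ≡ false
    β-not-inside x x∈β =
      subst (λ y → inOpen p α β y ≡ false) (sym (singleton-≡ {β} {x} x∈β)) (inOpen-last α β)

  endWeight-agree : ∀ {c d} → c ≡ d → endWeight c d ≡ wt p d
  endWeight-agree {white} refl = refl
  endWeight-agree {black} refl = refl

  endWeight-differ : ∀ {c d} → c ≢ d → endWeight c d ≡ + 0
  endWeight-differ {white} {white} c≢d = contradiction refl c≢d
  endWeight-differ {white} {black} _   = refl
  endWeight-differ {black} {white} _   = refl
  endWeight-differ {black} {black} c≢d = contradiction refl c≢d

  endWeight-additive : ∀ a c b → wt p c +ℤ endWeight a b ≡ endWeight a c +ℤ endWeight c b
  endWeight-additive white white white = refl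
  endWeight-additive white white black = refl
  endWeight-additive white black white = refl
  endWeight-additive white black black = refl
  endWeight-additive black white white = refl
  endWeight-additive black white black = refl
  endWeight-additive black black white = refl
  endWeight-additive black black black = refl

  δ-self : ∀ α → δ p α α ≡ Σp p
  δ-self α with _≟pt_ p α α
  ... | yes _  = refl
  ... | no α≢α = contradiction refl α≢α

  δ-apart : ∀ {α β} → α ≢ β → δ p α β ≡ σ p (inOpen p α β) +ℤ endWeight (ncol p α) (ncol p β)
  δ-apart {α} {β} α≢β with _≟pt_ p α β
  ... | yes α≡β = contradiction α≡β α≢β
  ... | no _ with ncol p α ≟c ncol p β
  ...   | yes same  = trans (σ-inHalf α β)
                            (cong (σ p (inOpen p α β) +ℤ_) (sym (endWeight-agree same)))
  ...   | no differ = sym (trans (cong (σ p (inOpen p α β) +ℤ_) (endWeight-differ differ))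
                                 (ℤ.+-identityʳ _))

  gap : Point p → Point p → ℕ
  gap α β = length (filter (λ x → inOpen p α β x Bool.≟ true) (allPoints p))

  module Inside (α β γ : Point p) (γ∈αβ : inOpen p α β γ ≡ true) where

    𝟙-split : ∀ x → 𝟙 (inOpen p α β x) ≡ 𝟙 (inOpen p α γ x) + 𝟙 (singleton γ x) + 𝟙 (inOpen p γ β x)
    𝟙-split x = cyclicOpen-split (pos p α) (pos p β) (pos p γ) (pos p x) γ∈αβ

    α≢γ : α ≢ γ
    α≢γ refl = not-¬ (inOpen-first α β) γ∈αβ

    γ≢β : γ ≢ β
    γ≢β refl = not-¬ (inOpen-last α β) γ∈αβ

    left⊆ : ∀ {x} → inOpen p α γ x ≡ true → inOpen p α β x ≡ true
    left⊆ {x} = 𝟙-≤⇒true {inOpen p α γ x} {inOpen p α β x}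
      (subst (𝟙 (inOpen p α γ x) ≤_) (sym (𝟙-split x)) (≤-trans (m≤m+n _ _) (m≤m+n _ _)))

    right⊆ : ∀ {x} → inOpen p γ β x ≡ true → inOpen p α β x ≡ true
    right⊆ {x} = 𝟙-≤⇒true {inOpen p γ β x} {inOpen p α β x}
      (subst (𝟙 (inOpen p γ β x) ≤_) (sym (𝟙-split x)) (m≤n+m _ _))

    gap-left< : gap α γ < gap α β
    gap-left< = length-filter-mono-< _ _ (λ {x} → left⊆ {x})
                  (∈-allPoints γ) (not-¬ (inOpen-last α γ)) γ∈αβ

    gap-right< : gap γ β < gap α β
    gap-right< = length-filter-mono-< _ _ (λ {x} → right⊆ {x})
                   (∈-allPoints γ) (not-¬ (inOpen-first γ β)) γ∈αβ

    σ-split : σ p (inOpen p α β) ≡ σ p (inOpen p α γ) +ℤ weight γ +ℤ σ p (inOpen p γ β)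
    σ-split = begin
      σ p (inOpen p α β)
        ≡⟨ σ≡mass (inOpen p α β) ⟩
      mass (𝟙 ∘ inOpen p α β)
        ≡⟨ mass-split (λ x → 𝟙 (inOpen p α γ x) + 𝟙 (singleton γ x)) (𝟙 ∘ inOpen p γ β) 𝟙-split ⟩
      mass (λ x → 𝟙 (inOpen p α γ x) + 𝟙 (singleton γ x)) +ℤ mass (𝟙 ∘ inOpen p γ β)
        ≡⟨ cong (_+ℤ mass (𝟙 ∘ inOpen p γ β))
                (mass-split (𝟙 ∘ inOpen p α γ) (𝟙 ∘ singleton γ) (λ _ → refl)) ⟩
      mass (𝟙 ∘ inOpen p α γ) +ℤ mass (𝟙 ∘ singleton γ) +ℤ mass (𝟙 ∘ inOpen p γ β)
        ≡⟨ sym (cong₂ _+ℤ_ (cong₂ _+ℤ_ (σ≡mass _) (σ≡mass _)) (σ≡mass _)) ⟩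
      σ p (inOpen p α γ) +ℤ σ p (singleton γ) +ℤ σ p (inOpen p γ β)
        ≡⟨ cong (λ s → σ p (inOpen p α γ) +ℤ s +ℤ σ p (inOpen p γ β)) (σ-singleton γ) ⟩
      σ p (inOpen p α γ) +ℤ weight γ +ℤ σ p (inOpen p γ β)
        ∎
      where open ≡-Reasoning

    δ-additive : α ≢ β → δ p α β ≡ δ p α γ +ℤ δ p γ β
    δ-additive α≢β = begin
      δ p α β
        ≡⟨ δ-apart α≢β ⟩
      σ p (inOpen p α β) +ℤ e α β
        ≡⟨ cong (_+ℤ e α β) σ-split ⟩
      σαγ +ℤ weight γ +ℤ σγβ +ℤ e α β
        ≡⟨ cong (_+ℤ e α β) (xy∙z≈xz∙y σαγ (weight γ) σγβ) ⟩
      σαγ +ℤ σγβ +ℤ weight γ +ℤ e α β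
        ≡⟨ ℤ.+-assoc (σαγ +ℤ σγβ) (weight γ) (e α β) ⟩
      σαγ +ℤ σγβ +ℤ (weight γ +ℤ e α β)
        ≡⟨ cong (σαγ +ℤ σγβ +ℤ_) (endWeight-additive (ncol p α) (ncol p γ) (ncol p β)) ⟩
      σαγ +ℤ σγβ +ℤ (e α γ +ℤ e γ β)
        ≡⟨ interchange σαγ σγβ (e α γ) (e γ β) ⟩
      (σαγ +ℤ e α γ) +ℤ (σγβ +ℤ e γ β)
        ≡⟨ sym (cong₂ _+ℤ_ (δ-apart α≢γ) (δ-apart γ≢β)) ⟩
      δ p α γ +ℤ δ p γ β
        ∎
      where
      open ≡-Reasoning
      σαγ σγβ : ℤ
      σαγ = σ p (inOpen p α γ)
      σγβ = σ p (inOpen p γ β)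
      e : Point p → Point p → ℤ
      e x y = endWeight (ncol p x) (ncol p y)

  leg-inside? : ∀ α β → Decidable (λ γ → inOpen p α β γ ≡ true × blk p γ ≡ blk p α)
  leg-inside? α β γ = (inOpen p α β γ Bool.≟ true) ×-dec (blk p γ ≟ blk p α)

  module _ {m : ℕ} (consecutive-divisible : ∀ α β → Consecutive p α β → + m ∣ δ p α β) where

    δ-divisible-apart : ∀ α β → Acc _<_ (gap α β) → SameBlock p α β → α ≢ β → + m ∣ δ p α β
    δ-divisible-apart α β (acc smaller) α~β α≢β with any? (leg-inside? α β) (allPoints p)
    ... | no no-leg = consecutive-divisible α β
          (α~β , α≢β , λ γ γ∈αβ γ~α → no-leg (lose (∈-allPoints γ) (γ∈αβ , γ~α)))
    ... | yes some-leg with satisfied some-leg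
    ...   | γ , γ∈αβ , γ~α = subst (+ m ∣_) (sym (δ-additive α≢β))
            (∣m∣n⇒∣m+n {+ m} {δ p α γ} {δ p γ β}
              (δ-divisible-apart α γ (smaller gap-left<) (sym γ~α) α≢γ)
              (δ-divisible-apart γ β (smaller gap-right<) (trans γ~α α~β) γ≢β))
      where open Inside α β γ γ∈αβ

    δ-divisible : + m ∣ Σp p → ∀ α β → SameBlock p α β → + m ∣ δ p α β
    δ-divisible m∣Σ α β α~β = by-cases (_≟pt_ p α β)
      where
      by-cases : Dec (α ≡ β) → + m ∣ δ p α β
      by-cases (yes refl) = subst (+ m ∣_) (sym (δ-self α)) m∣Σ
      by-cases (no α≢β)   = δ-divisible-apart α β (<-wellFounded _) α~β α≢β

blockSize-positive : ∀ p x → 1 ≤ blockSize p x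
blockSize-positive p x = ∈-length (∈-filter⁺ (λ y → blk p x ≟ blk p y) (∈-allPoints p x) refl)

Σp-divisible : ∀ {m} p → (∀ α β → SameBlock p α β → + m ∣ δ p α β) → + m ∣ Σp p
Σp-divisible {m} record { k = zero ; l = zero } _ = m ℕ.∣0
Σp-divisible {m} p@record { k = suc _ } δ-div =
  subst (+ m ∣_) (δ-self p (inj₁ fzero)) (δ-div (inj₁ fzero) (inj₁ fzero) refl)
Σp-divisible {m} p@record { k = zero ; l = suc _ } δ-div =
  subst (+ m ∣_) (δ-self p (inj₂ fzero)) (δ-div (inj₂ fzero) (inj₂ fzero) refl)

module _ (m : ℕ) (p : Partition) where

  Z≤Q⇒δ-divisible : Z (λ q → q ≡ p) ≤Z Q m → ∀ α β → SameBlock p α β → + m ∣ δ p α β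
  Z≤Q⇒δ-divisible (_ , _ , Σ⊆mℤ , L⊆mℤ , K⊆mℤ , _) =
    δ-divisible p consecutive (Σ⊆mℤ _ (p , refl , refl))
    where
    consecutive : ∀ α β → Consecutive p α β → + m ∣ δ p α β
    consecutive α β α-β with σ p (pair p α β) ℤ.≟ + 0
    ... | yes σ≡0 = K⊆mℤ _ (p , refl , α , β , α-β , σ≡0 , refl)
    ... | no σ≢0  = L⊆mℤ _ (p , refl , α , β , α-β , σ≢0 , refl)

  δ-divisible⇒Z≤Q : (∀ α β → SameBlock p α β → + m ∣ δ p α β) → Z (λ q → q ≡ p) ≤Z Q m
  δ-divisible⇒Z≤Q δ-div =
      (λ { _ (_ , refl , x , refl) → blockSize-positive p x })
    , (λ _ _ → tt)
    , (λ { _ (_ , refl , refl) → Σp-divisible p δ-div })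
    , (λ { _ (_ , refl , α , β , (α~β , _) , _ , refl) → δ-div α β α~β })
    , (λ { _ (_ , refl , α , β , (α~β , _) , _ , refl) → δ-div α β α~β })
    , (λ _ _ → tt)

lemma6p11 : (m : ℕ) (p : Partition) →
    (Z (λ q → q ≡ p) ≤Z Q m) ⇔
    (∀ (α β : Point p) → SameBlock p α β → (+ m) ∣ δ p α β)
lemma6p11 m p = mk⇔ (Z≤Q⇒δ-divisible m p) (δ-divisible⇒Z≤Q m p)
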